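{- Every finite cograph has relational complexity at most $2$.
   Context: A cograph is a graph containing no induced path on $4$ vertices. Graphs are viewed as relational structures with one symmetric irreflexive binary relation. A structure is ultrahomogeneous if every isomorphism between finite induced substructures extends to an automorphism. The relational complexity $\mathrm{rc}(\mathbf{G})$ is the least $k\ge0$ such that adding to $\mathbf{G}$ all relations $\rho\subseteq V^{k'}$, $1\le k'\le k$, invariant under $\mathrm{Aut}(\mathbf{G})$ yields an ultrahomogeneous structure. -}

module Defs where

open import Data.Nat using (ℕ; _≤_)
open import Data.Fin using (Fin)
open import Data.Bool using (Bool; true; false)
open import Data.Unit using (⊤)
open import Data.Sum using (_⊎_; inj₁; inj₂)
open import Data.Product using (Σ; _×_; _,_; ∃-syntax)
open import Data.Empty using (⊥)
open import Relation.Nullary using (¬_)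
open import Relation.Binary.PropositionalEquality using (_≡_; _≢_)
open import Function using (_∘_; Injective)
open import Data.Fin.Permutation using (Permutation′; _⟨$⟩ʳ_)

record Graph (n : ℕ) : Set where
  field
    E     : Fin n → Fin n → Bool
    sym   : ∀ x y → E x y ≡ E y x
    irrefl : ∀ x → E x x ≡ false

open Graph public

-- A cograph: no induced path on 4 (distinct) vertices a - b - c - d.
IsCograph : ∀ {n} → Graph n → Set
IsCograph {n} G = (a b c d : Fin n) →
  a ≢ b → a ≢ c → a ≢ d → b ≢ c → b ≢ d → c ≢ d →
  E G a b ≡ true → E G b c ≡ true → E G c d ≡ true →
  E G a c ≡ false → E G b d ≡ false → E G a d ≡ false → ⊥

record Structure (n : ℕ) : Set₁ where
  field
    Sym   : Set
    arity : Sym → ℕ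
    rel   : (s : Sym) → (Fin (arity s) → Fin n) → Bool

open Structure public

IsAut : ∀ {n} → Structure n → Permutation′ n → Set
IsAut S g = ∀ (s : Sym S) (t : Fin (arity S s) → _) →
  rel S s ((g ⟨$⟩ʳ_) ∘ t) ≡ rel S s t

-- A finite partial map between induced substructures is given by two
-- injective enumerations a, b : Fin m → Fin n, sending a i ↦ b i.
IsPartialIso : ∀ {n m} → Structure n → (a b : Fin m → Fin n) → Set
IsPartialIso S a b = ∀ (s : Sym S) (t : Fin (arity S s) → _) →
  rel S s (b ∘ t) ≡ rel S s (a ∘ t)

Ultrahomogeneous : ∀ {n} → Structure n → Set
Ultrahomogeneous {n} S = ∀ (m : ℕ) (a b : Fin m → Fin n) →
  Injective _≡_ _≡_ a → Injective _≡_ _≡_ b →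
  IsPartialIso S a b →
  ∃[ g ] (IsAut S g × (∀ i → g ⟨$⟩ʳ a i ≡ b i))

graphStructure : ∀ {n} → Graph n → Structure n
graphStructure G = record
  { Sym = ⊤ ; arity = λ _ → 2 ; rel = λ _ t → E G (t Data.Fin.zero) (t (Data.Fin.suc Data.Fin.zero)) }

IsGraphAut : ∀ {n} → Graph n → Permutation′ n → Set
IsGraphAut G = IsAut (graphStructure G)

IsInvariant : ∀ {n} (G : Graph n) (k : ℕ) → ((Fin k → Fin n) → Bool) → Set
IsInvariant G k ρ = ∀ g → IsGraphAut G g → ∀ t → ρ ((g ⟨$⟩ʳ_) ∘ t) ≡ ρ t

InvSym : ∀ {n} → Graph n → ℕ → Set
InvSym {n} G k = Σ ℕ λ k' → (1 ≤ k' × k' ≤ k) × Σ ((Fin k' → Fin n) → Bool) (IsInvariant G k')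

expansion : ∀ {n} → Graph n → ℕ → Structure n
expansion {n} G k = record
  { Sym = ⊤ ⊎ InvSym G k
  ; arity = ar
  ; rel = r
  }
  where
  ar : ⊤ ⊎ InvSym G k → ℕ
  ar (inj₁ _) = 2
  ar (inj₂ (k' , _)) = k'
  r : (s : ⊤ ⊎ InvSym G k) → (Fin (ar s) → Fin n) → Bool
  r (inj₁ _) t = E G (t Data.Fin.zero) (t (Data.Fin.suc Data.Fin.zero))
  r (inj₂ (k' , _ , ρ , _)) t = ρ t

-- rc(G) ≤ k : some k₀ ≤ k makes the expansion ultrahomogeneous
-- (rc is the least such k₀).
RelComplexity≤ : ∀ {n} → Graph n → ℕ → Set
RelComplexity≤ G k = ∃[ k₀ ] (k₀ ≤ k × Ultrahomogeneous (expansion G k₀))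

-- For every pair w of vertices, "lies in the Aut(G)-orbit of w" is an
-- invariant binary relation, so a partial isomorphism of the expansion by all
-- invariant binary relations maps each pair of its domain into the same orbit;
-- it remains to see that in a cograph the orbits of pairs determine the orbits
-- of tuples. Adding the points of a tuple one at a time, this reduces to: if x
-- can be moved to y by automorphisms fixing s₁, …, sₘ each separately, then by
-- one fixing all of them. We prove this for automorphisms of induced subgraphs
-- G[U], by induction on U. By Seinsche's theorem G[U] or its complement (which
-- has the same automorphisms) is disconnected unless U is a singleton, and in a
-- cograph two vertices of the same component are at distance at most 2. If x
-- and y lie in one component C, the automorphisms involved preserve C and the
-- induction hypothesis applies to G[C]. Otherwise, an automorphism h with h x = y
-- maps the component of x onto that of y, and swapping these two components by
-- h fixes every sᵢ, since an automorphism fixing sᵢ also maps the first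
-- component onto the second, so sᵢ lies in neither.
module Submission where

open import Defs renaming (sym to edge-sym)
open import Data.Bool using (Bool; true; false; not; _∧_)
open import Data.Bool.Properties using (not-involutive; not-injective; ¬-not)
import Data.Bool.Properties as Bool
open import Data.Empty using (⊥; ⊥-elim)
open import Data.Fin using (Fin; zero; suc; _≟_)
open import Data.Fin.Permutation
  using (Permutation′; permutation; _⟨$⟩ʳ_; _⟨$⟩ˡ_; _≈_; id; flip; _∘ₚ_; inverseˡ; inverseʳ)
open import Data.Fin.Properties using (any?; all?)
open import Data.Fin.Subset using (Subset; _∈_; _∉_; _⊆_; _⊂_; ⊤)
open import Data.Fin.Subset.Induction using (⊂-wellFounded; Acc; acc)
open import Data.Fin.Subset.Properties using (_∈?_; ∈⊤)
open import Data.Nat using (ℕ; zero; suc; z≤n; s≤s)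
open import Data.Nat.Properties using (≤-refl)
open import Data.Product using (Σ; ∃; ∃-syntax; _×_; _,_; proj₁; proj₂)
open import Data.Sum using (_⊎_; inj₁; inj₂)
open import Data.Vec as Vec using (Vec; tabulate; lookup)
open import Data.Vec.Functional using (Vector; []; _∷_)
open import Data.Vec.Properties using (lookup∘tabulate; lookup⇒[]=; []=⇒lookup)
open import Function using (_∘′_)
open import Function.Bundles using (mk⇔)
open import Function.Definitions using (StrictlyInverseˡ; StrictlyInverseʳ)
open import Relation.Binary.PropositionalEquality
open import Relation.Nullary using (¬_; Dec; does; yes; no; contradiction)
open import Relation.Nullary.Decidable
  using (_×-dec_; _⊎-dec_; ¬?; map′; dec-true; does-⇔; decidable-stable)
open import Relation.Unary using (Decidable)

private variable
  n m : ℕ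
  G H : Graph n
  U C : Subset n
  g h k : Permutation′ n
  x y z w : Fin n
  s : Vector (Fin n) m

does≡true⇒ : ∀ {P : Set} (P? : Dec P) → does P? ≡ true → P
does≡true⇒ (yes p) _ = p

fromDecidable : {P : Fin n → Set} → Decidable P → Subset n
fromDecidable P? = tabulate (λ z → does (P? z))

module _ {P : Fin n → Set} (P? : Decidable P) where

  ∈-fromDecidable⁺ : P z → z ∈ fromDecidable P?
  ∈-fromDecidable⁺ {z} p =
    lookup⇒[]= z _ (trans (lookup∘tabulate _ z) (dec-true (P? z) p))

  ∈-fromDecidable⁻ : z ∈ fromDecidable P? → P z
  ∈-fromDecidable⁻ {z} z∈ =
    does≡true⇒ (P? z) (trans (sym (lookup∘tabulate _ z)) ([]=⇒lookup z∈))

fromDecidable-⊂ : {P : Fin n → Set} (P? : Decidable P) →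
  (∀ {z} → P z → z ∈ U) → x ∈ U → ¬ P x → fromDecidable P? ⊂ U
fromDecidable-⊂ P? P⊆U x∈U ¬Px =
  (λ z∈ → P⊆U (∈-fromDecidable⁻ P? z∈)) , _ , x∈U , ¬Px ∘′ ∈-fromDecidable⁻ P?

private
  in-∖? : (U : Subset n) (v : Fin n) → Decidable (λ z → z ∈ U × z ≢ v)
  in-∖? U v z = z ∈? U ×-dec ¬? (z ≟ v)

opaque
  _∖_ : Subset n → Fin n → Subset n
  U ∖ v = fromDecidable (in-∖? U v)

  ∈-∖⁺ : z ∈ U → z ≢ y → z ∈ U ∖ y
  ∈-∖⁺ {U = U} {y = y} z∈U z≢y = ∈-fromDecidable⁺ (in-∖? U y) (z∈U , z≢y)

  ∈-∖⁻ : z ∈ U ∖ y → z ∈ U × z ≢ y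
  ∈-∖⁻ {U = U} {y = y} = ∈-fromDecidable⁻ (in-∖? U y)

  ∖-⊂ : y ∈ U → U ∖ y ⊂ U
  ∖-⊂ {y = y} {U = U} y∈U = fromDecidable-⊂ (in-∖? U y) proj₁ y∈U (λ (_ , y≢y) → y≢y refl)

-- Cographs and complements

true≢false : true ≢ false
true≢false ()

edge⇒≢ : (G : Graph n) → E G x y ≡ true → x ≢ y
edge⇒≢ G xy refl = true≢false (trans (sym xy) (irrefl G _))

no-P4 : ∀ {a b c d} → IsCograph G →
  E G a b ≡ true → E G b c ≡ true → E G c d ≡ true →
  E G a c ≡ false → E G b d ≡ false → E G a d ≡ false → ⊥
no-P4 {G = G} {a} {b} {c} {d} cograph ab bc cd ac bd ad =
  cograph a b c d (edge⇒≢ G ab) a≢c a≢d (edge⇒≢ G bc) b≢d (edge⇒≢ G cd) ab bc cd ac bd ad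
  where
  a≢c : a ≢ c
  a≢c refl = true≢false (trans (sym cd) ad)
  b≢d : b ≢ d
  b≢d refl = true≢false (trans (sym ab) ad)
  a≢d : a ≢ d
  a≢d refl = true≢false (trans (sym cd) (trans (edge-sym G c a) ac))

complement : Graph n → Graph n
complement G = record
  { E = λ x y → not (does (x ≟ y)) ∧ not (E G x y) ; sym = E̅-sym ; irrefl = E̅-irrefl }
  where
  E̅-sym : ∀ x y → not (does (x ≟ y)) ∧ not (E G x y) ≡ not (does (y ≟ x)) ∧ not (E G y x)
  E̅-sym x y with x ≟ y | y ≟ x
  ... | yes _   | yes _   = refl
  ... | yes x≡y | no y≢x  = contradiction (sym x≡y) y≢x
  ... | no x≢y  | yes y≡x = contradiction (sym y≡x) x≢y
  ... | no _    | no _    = cong not (edge-sym G x y)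
  E̅-irrefl : ∀ x → not (does (x ≟ x)) ∧ not (E G x x) ≡ false
  E̅-irrefl x with x ≟ x
  ... | yes _   = refl
  ... | no x≢x  = contradiction refl x≢x

-- A symmetric relation, so that G and its complement play interchangeable roles
-- (complement (complement G) is G only pointwise).
record Complementary (G H : Graph n) : Set where
  constructor complementary
  field off-diagonal : ∀ {x y} → x ≢ y → E H x y ≡ not (E G x y)
open Complementary

complement-complementary : Complementary G (complement G)
complement-complementary {G = G} = complementary λ {x} {y} x≢y → off-diagonal′ x y x≢y
  where
  off-diagonal′ : ∀ x y → x ≢ y → not (does (x ≟ y)) ∧ not (E G x y) ≡ not (E G x y)
  off-diagonal′ x y x≢y with x ≟ y
  ... | yes x≡y = contradiction x≡y x≢y
  ... | no _    = refl

complementary-sym : Complementary G H → Complementary H G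
complementary-sym {G = G} c = complementary λ {x} {y} x≢y →
  trans (sym (not-involutive (E G x y))) (cong not (sym (off-diagonal c x≢y)))

complementary-edge : Complementary G H → E H x y ≡ true → E G x y ≡ false
complementary-edge {G = G} {H} {x} {y} c xy =
  not-injective (trans (sym (off-diagonal c (edge⇒≢ H xy))) xy)

complementary-nonedge : Complementary G H → x ≢ y → E H x y ≡ false → E G x y ≡ true
complementary-nonedge {G = G} {H} c x≢y xy = not-injective (trans (sym (off-diagonal c x≢y)) xy)

complementary-isCograph : Complementary G H → IsCograph G → IsCograph H
complementary-isCograph {G = G} {H} G∁H cograph a b c d a≢b a≢c a≢d b≢c b≢d c≢d ab bc cd ac bd ad =
  no-P4 {G = G} cograph
    (complementary-nonedge G∁H b≢d bd)
    (complementary-nonedge G∁H (λ d≡a → a≢d (sym d≡a)) (trans (edge-sym H d a) ad))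
    (complementary-nonedge G∁H a≢c ac)
    (trans (edge-sym G b a) (complementary-edge G∁H ab))
    (trans (edge-sym G d c) (complementary-edge G∁H cd))
    (complementary-edge G∁H bc)

-- Automorphisms of induced subgraphs

⟨$⟩ʳ-injective : (g : Permutation′ n) → g ⟨$⟩ʳ x ≡ g ⟨$⟩ʳ y → x ≡ y
⟨$⟩ʳ-injective g e = trans (sym (inverseˡ g)) (trans (cong (g ⟨$⟩ˡ_) e) (inverseˡ g))

⟨$⟩ʳ⇒⟨$⟩ˡ : (g : Permutation′ n) → g ⟨$⟩ʳ x ≡ y → g ⟨$⟩ˡ y ≡ x
⟨$⟩ʳ⇒⟨$⟩ˡ g refl = inverseˡ g

-- Automorphisms of the induced subgraph G[U], extended by the identity off U.
record IsAutOn (G : Graph n) (U : Subset n) (g : Permutation′ n) : Set where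
  field
    fixes-outside   : x ∉ U → g ⟨$⟩ʳ x ≡ x
    preserves-edges : x ∈ U → y ∈ U → E G (g ⟨$⟩ʳ x) (g ⟨$⟩ʳ y) ≡ E G x y
open IsAutOn

module _ (g-aut : IsAutOn G U g) where

  IsAutOn-∈ : x ∈ U → g ⟨$⟩ʳ x ∈ U
  IsAutOn-∈ {x} x∈U with g ⟨$⟩ʳ x ∈? U
  ... | yes gx∈U = gx∈U
  ... | no gx∉U  = contradiction x∈U
    (subst (_∉ U) (⟨$⟩ʳ-injective g (fixes-outside g-aut gx∉U)) gx∉U)

  IsAutOn-∈⁻¹ : x ∈ U → g ⟨$⟩ˡ x ∈ U
  IsAutOn-∈⁻¹ {x} x∈U with g ⟨$⟩ˡ x ∈? U
  ... | yes g⁻¹x∈U = g⁻¹x∈U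
  ... | no g⁻¹x∉U  = contradiction x∈U
    (subst (_∉ U) (trans (sym (fixes-outside g-aut g⁻¹x∉U)) (inverseʳ g)) g⁻¹x∉U)

  IsAutOn-flip : IsAutOn G U (flip g)
  IsAutOn-flip = record
    { fixes-outside   = λ x∉U →
        trans (cong (g ⟨$⟩ˡ_) (sym (fixes-outside g-aut x∉U))) (inverseˡ g)
    ; preserves-edges = λ x∈U y∈U → trans
        (sym (preserves-edges g-aut (IsAutOn-∈⁻¹ x∈U) (IsAutOn-∈⁻¹ y∈U)))
        (cong₂ (E G) (inverseʳ g) (inverseʳ g))
    }

  IsAutOn-∘ : IsAutOn G U h → IsAutOn G U (g ∘ₚ h)
  IsAutOn-∘ {h = h} h-aut = record
    { fixes-outside   = λ x∉U →
        trans (cong (h ⟨$⟩ʳ_) (fixes-outside g-aut x∉U)) (fixes-outside h-aut x∉U)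
    ; preserves-edges = λ x∈U y∈U → trans
        (preserves-edges h-aut (IsAutOn-∈ x∈U) (IsAutOn-∈ y∈U))
        (preserves-edges g-aut x∈U y∈U)
    }

  IsAutOn-complementary : Complementary G H → IsAutOn H U g
  IsAutOn-complementary {H = H} G∁H = record
    { fixes-outside   = fixes-outside g-aut
    ; preserves-edges = edges
    }
    where
    edges : x ∈ U → y ∈ U → E H (g ⟨$⟩ʳ x) (g ⟨$⟩ʳ y) ≡ E H x y
    edges {x} {y} x∈U y∈U with x ≟ y
    ... | yes refl = trans (irrefl H _) (sym (irrefl H x))
    ... | no x≢y   = begin
      E H (g ⟨$⟩ʳ x) (g ⟨$⟩ʳ y)  ≡⟨ off-diagonal G∁H (x≢y ∘′ ⟨$⟩ʳ-injective g) ⟩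
      not (E G (g ⟨$⟩ʳ x) (g ⟨$⟩ʳ y)) ≡⟨ cong not (preserves-edges g-aut x∈U y∈U) ⟩
      not (E G x y)              ≡⟨ sym (off-diagonal G∁H x≢y) ⟩
      E H x y                    ∎
      where open ≡-Reasoning

IsAutOn-id : IsAutOn G U id
IsAutOn-id = record { fixes-outside = λ _ → refl ; preserves-edges = λ _ _ → refl }

IsAutOn⊤⇒IsGraphAut : IsAutOn G ⊤ g → IsGraphAut G g
IsAutOn⊤⇒IsGraphAut g-aut _ t = preserves-edges g-aut ∈⊤ ∈⊤

IsGraphAut⇒IsAutOn⊤ : IsGraphAut G g → IsAutOn G ⊤ g
IsGraphAut⇒IsAutOn⊤ g-aut = record
  { fixes-outside   = λ x∉⊤ → contradiction ∈⊤ x∉⊤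
  ; preserves-edges = λ {x} {y} _ _ → g-aut _ λ { zero → x ; (suc _) → y }
  }

record IsComponentUnion (G : Graph n) (U C : Subset n) : Set where
  field
    ⊆U          : C ⊆ U
    no-edge-out : z ∈ C → w ∈ U → w ∉ C → E G z w ≡ false
open IsComponentUnion

IsAutOn-extend : IsComponentUnion G U C → IsAutOn G C g → IsAutOn G U g
IsAutOn-extend {G = G} {U} {C} {g} C-union g-aut = record
  { fixes-outside   = λ x∉U → fixes-outside g-aut (x∉U ∘′ ⊆U C-union)
  ; preserves-edges = edges
  }
  where
  across : z ∈ C → w ∈ U → w ∉ C → E G (g ⟨$⟩ʳ z) (g ⟨$⟩ʳ w) ≡ E G z w
  across z∈C w∈U w∉C = begin
    E G (g ⟨$⟩ʳ _) (g ⟨$⟩ʳ _) ≡⟨ cong (E G _) (fixes-outside g-aut w∉C) ⟩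
    E G (g ⟨$⟩ʳ _) _          ≡⟨ no-edge-out C-union (IsAutOn-∈ g-aut z∈C) w∈U w∉C ⟩
    false                     ≡⟨ sym (no-edge-out C-union z∈C w∈U w∉C) ⟩
    E G _ _                   ∎
    where open ≡-Reasoning
  edges : x ∈ U → y ∈ U → E G (g ⟨$⟩ʳ x) (g ⟨$⟩ʳ y) ≡ E G x y
  edges {x} {y} x∈U y∈U with x ∈? C | y ∈? C
  ... | yes x∈C | yes y∈C = preserves-edges g-aut x∈C y∈C
  ... | yes x∈C | no y∉C  = across x∈C y∈U y∉C
  ... | no x∉C  | yes y∈C =
    trans (edge-sym G _ _) (trans (across y∈C x∈U x∉C) (edge-sym G y x))
  ... | no x∉C  | no y∉C  = cong₂ (E G) (fixes-outside g-aut x∉C) (fixes-outside g-aut y∉C)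

within : Subset n → (Fin n → Fin n) → Fin n → Fin n
within C f z with z ∈? C
... | yes _ = f z
... | no _  = z

module _ {f : Fin n → Fin n} where

  within-∈ : z ∈ C → within C f z ≡ f z
  within-∈ {z} {C} z∈C with z ∈? C
  ... | yes _   = refl
  ... | no z∉C  = contradiction z∈C z∉C

  within-∉ : z ∉ C → within C f z ≡ z
  within-∉ {z} {C} z∉C with z ∈? C
  ... | yes z∈C = contradiction z∈C z∉C
  ... | no _    = refl

module Restrict (C : Subset n) (k : Permutation′ n)
  (k[C]⊆C : ∀ {z} → z ∈ C → k ⟨$⟩ʳ z ∈ C) (k⁻¹[C]⊆C : ∀ {z} → z ∈ C → k ⟨$⟩ˡ z ∈ C) where

  restrict : Permutation′ n
  restrict = permutation (within C (k ⟨$⟩ʳ_)) (within C (k ⟨$⟩ˡ_)) right left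
    where
    right : ∀ z → within C (k ⟨$⟩ʳ_) (within C (k ⟨$⟩ˡ_) z) ≡ z
    right z with z ∈? C
    ... | yes z∈C = trans (within-∈ (k⁻¹[C]⊆C z∈C)) (inverseʳ k)
    ... | no z∉C  = within-∉ z∉C
    left : ∀ z → within C (k ⟨$⟩ˡ_) (within C (k ⟨$⟩ʳ_) z) ≡ z
    left z with z ∈? C
    ... | yes z∈C = trans (within-∈ (k[C]⊆C z∈C)) (inverseˡ k)
    ... | no z∉C  = within-∉ z∉C

  restrict-∈ : z ∈ C → restrict ⟨$⟩ʳ z ≡ k ⟨$⟩ʳ z
  restrict-∈ = within-∈

  restrict-∉ : z ∉ C → restrict ⟨$⟩ʳ z ≡ z
  restrict-∉ = within-∉

  restrict-fixes : k ⟨$⟩ʳ z ≡ z → restrict ⟨$⟩ʳ z ≡ z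
  restrict-fixes {z} kz with z ∈? C
  ... | yes _ = kz
  ... | no _  = refl

  IsAutOn-restrict : C ⊆ U → IsAutOn G U k → IsAutOn G C restrict
  IsAutOn-restrict {G = G} C⊆U k-aut = record
    { fixes-outside   = restrict-∉
    ; preserves-edges = λ x∈C y∈C → trans (cong₂ (E G) (restrict-∈ x∈C) (restrict-∈ y∈C))
                                          (preserves-edges k-aut (C⊆U x∈C) (C⊆U y∈C))
    }

module Swap (C D : Subset n) (h : Permutation′ n) (C∩D=∅ : ∀ {z} → z ∈ C → z ∉ D)
  (h[C]⊆D : ∀ {z} → z ∈ C → h ⟨$⟩ʳ z ∈ D) (h⁻¹[D]⊆C : ∀ {z} → z ∈ D → h ⟨$⟩ˡ z ∈ C) where

  private
    τ : Fin n → Fin n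
    τ z with z ∈? C | z ∈? D
    ... | yes _ | _     = h ⟨$⟩ʳ z
    ... | no _  | yes _ = h ⟨$⟩ˡ z
    ... | no _  | no _  = z

    D∩C=∅ : z ∈ D → z ∉ C
    D∩C=∅ z∈D z∈C = C∩D=∅ z∈C z∈D

    τ-∈C : z ∈ C → τ z ≡ h ⟨$⟩ʳ z
    τ-∈C {z} z∈C with z ∈? C
    ... | yes _   = refl
    ... | no z∉C  = contradiction z∈C z∉C

    τ-∈D : z ∈ D → τ z ≡ h ⟨$⟩ˡ z
    τ-∈D {z} z∈D with z ∈? C | z ∈? D
    ... | yes z∈C | _       = contradiction z∈D (C∩D=∅ z∈C)
    ... | no _    | yes _   = refl
    ... | no _    | no z∉D  = contradiction z∈D z∉D

    τ-outside : z ∉ C → z ∉ D → τ z ≡ z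
    τ-outside {z} z∉C z∉D with z ∈? C | z ∈? D
    ... | yes z∈C | _       = contradiction z∈C z∉C
    ... | no _    | yes z∈D = contradiction z∈D z∉D
    ... | no _    | no _    = refl

    data Part (z : Fin n) : Set where
      in-C    : z ∈ C → Part z
      in-D    : z ∈ D → Part z
      outside : z ∉ C → z ∉ D → Part z

    part : ∀ z → Part z
    part z with z ∈? C | z ∈? D
    ... | yes z∈C | _       = in-C z∈C
    ... | no _    | yes z∈D = in-D z∈D
    ... | no z∉C  | no z∉D  = outside z∉C z∉D

    involutive : ∀ z → τ (τ z) ≡ z
    involutive z with z ∈? C | z ∈? D
    ... | yes z∈C | _       = trans (τ-∈D (h[C]⊆D z∈C)) (inverseˡ h)
    ... | no _    | yes z∈D = trans (τ-∈C (h⁻¹[D]⊆C z∈D)) (inverseʳ h)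
    ... | no z∉C  | no z∉D  = τ-outside z∉C z∉D

    τ[C]⊆D : z ∈ C → τ z ∈ D
    τ[C]⊆D z∈C = subst (_∈ D) (sym (τ-∈C z∈C)) (h[C]⊆D z∈C)

    τ[D]⊆C : z ∈ D → τ z ∈ C
    τ[D]⊆C z∈D = subst (_∈ C) (sym (τ-∈D z∈D)) (h⁻¹[D]⊆C z∈D)

    τ-∉D : z ∉ C → τ z ∉ D
    τ-∉D {z} z∉C with z ∈? C | z ∈? D
    ... | yes z∈C | _       = contradiction z∈C z∉C
    ... | no _    | yes z∈D = C∩D=∅ (h⁻¹[D]⊆C z∈D)
    ... | no _    | no z∉D  = z∉D

    τ-∉C : z ∉ D → τ z ∉ C
    τ-∉C {z} z∉D with z ∈? C | z ∈? D
    ... | yes z∈C | _       = D∩C=∅ (h[C]⊆D z∈C)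
    ... | no _    | yes z∈D = contradiction z∈D z∉D
    ... | no z∉C  | no _    = z∉C

  swap : Permutation′ n
  swap = permutation τ τ involutive involutive

  swap-∈C : z ∈ C → swap ⟨$⟩ʳ z ≡ h ⟨$⟩ʳ z
  swap-∈C = τ-∈C

  swap-outside : z ∉ C → z ∉ D → swap ⟨$⟩ʳ z ≡ z
  swap-outside = τ-outside

  IsAutOn-swap : IsComponentUnion G U C → IsComponentUnion G U D → IsAutOn G U h →
    IsAutOn G U swap
  IsAutOn-swap {G = G} {U} C-union D-union h-aut = record
    { fixes-outside   = λ x∉U → τ-outside (x∉U ∘′ ⊆U C-union) (x∉U ∘′ ⊆U D-union)
    ; preserves-edges = edges
    }
    where
    τ-∈U : z ∈ U → τ z ∈ U
    τ-∈U {z} z∈U with z ∈? C | z ∈? D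
    ... | yes z∈C | _       = ⊆U D-union (h[C]⊆D z∈C)
    ... | no _    | yes z∈D = ⊆U C-union (h⁻¹[D]⊆C z∈D)
    ... | no _    | no _    = z∈U

    across : ∀ {X Y} → IsComponentUnion G U X → IsComponentUnion G U Y →
      z ∈ X → w ∈ U → w ∉ X → τ z ∈ Y → τ w ∉ Y → E G (τ z) (τ w) ≡ E G z w
    across X-union Y-union z∈X w∈U w∉X τz∈Y τw∉Y =
      trans (no-edge-out Y-union τz∈Y (τ-∈U w∈U) τw∉Y) (sym (no-edge-out X-union z∈X w∈U w∉X))

    flipped : E G (τ w) (τ z) ≡ E G w z → E G (τ z) (τ w) ≡ E G z w
    flipped {w} {z} e = trans (edge-sym G (τ z) (τ w)) (trans e (edge-sym G w z))

    edges : x ∈ U → y ∈ U → E G (τ x) (τ y) ≡ E G x y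
    edges {x} {y} x∈U y∈U with part x | part y
    ... | in-C x∈C        | in-C y∈C        =
      trans (cong₂ (E G) (τ-∈C x∈C) (τ-∈C y∈C)) (preserves-edges h-aut x∈U y∈U)
    ... | in-C x∈C        | in-D y∈D        =
      across C-union D-union x∈C y∈U (D∩C=∅ y∈D) (τ[C]⊆D x∈C) (τ-∉D (D∩C=∅ y∈D))
    ... | in-C x∈C        | outside y∉C _   =
      across C-union D-union x∈C y∈U y∉C (τ[C]⊆D x∈C) (τ-∉D y∉C)
    ... | in-D x∈D        | in-D y∈D        =
      trans (cong₂ (E G) (τ-∈D x∈D) (τ-∈D y∈D)) (preserves-edges (IsAutOn-flip h-aut) x∈U y∈U)
    ... | in-D x∈D        | in-C y∈C        =
      across D-union C-union x∈D y∈U (C∩D=∅ y∈C) (τ[D]⊆C x∈D) (τ-∉C (C∩D=∅ y∈C))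
    ... | in-D x∈D        | outside _ y∉D   =
      across D-union C-union x∈D y∈U y∉D (τ[D]⊆C x∈D) (τ-∉C y∉D)
    ... | outside x∉C _   | in-C y∈C        =
      flipped (across C-union D-union y∈C x∈U x∉C (τ[C]⊆D y∈C) (τ-∉D x∉C))
    ... | outside _ x∉D   | in-D y∈D        =
      flipped (across D-union C-union y∈D x∈U x∉D (τ[D]⊆C y∈D) (τ-∉C x∉D))
    ... | outside x∉C x∉D | outside y∉C y∉D =
      cong₂ (E G) (τ-outside x∉C x∉D) (τ-outside y∉C y∉D)

-- Components of cographs

data Dist≤2 (G : Graph n) (U : Subset n) (x : Fin n) : Fin n → Set where
  dist0 : Dist≤2 G U x x
  dist1 : E G x z ≡ true → Dist≤2 G U x z
  dist2 : w ∈ U → E G x w ≡ true → E G w z ≡ true → Dist≤2 G U x z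

dist≤2? : (G : Graph n) (U : Subset n) (x z : Fin n) → Dec (Dist≤2 G U x z)
dist≤2? G U x z = map′ from to
  (x ≟ z ⊎-dec E G x z Bool.≟ true ⊎-dec
   any? (λ w → w ∈? U ×-dec E G x w Bool.≟ true ×-dec E G w z Bool.≟ true))
  where
  Unfolded : Set
  Unfolded = x ≡ z ⊎ E G x z ≡ true ⊎ ∃[ w ] (w ∈ U × E G x w ≡ true × E G w z ≡ true)
  from : Unfolded → Dist≤2 G U x z
  from (inj₁ refl)                        = dist0
  from (inj₂ (inj₁ xz))                   = dist1 xz
  from (inj₂ (inj₂ (w , w∈U , xw , wz))) = dist2 w∈U xw wz
  to : Dist≤2 G U x z → Unfolded
  to dist0               = inj₁ refl
  to (dist1 xz)          = inj₂ (inj₁ xz)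
  to (dist2 w∈U xw wz)   = inj₂ (inj₂ (_ , w∈U , xw , wz))

dist≤2-sym : Dist≤2 G U x z → Dist≤2 G U z x
dist≤2-sym dist0                           = dist0
dist≤2-sym {G = G} (dist1 xz)              = dist1 (trans (edge-sym G _ _) xz)
dist≤2-sym {G = G} (dist2 w∈U xw wz)       =
  dist2 w∈U (trans (edge-sym G _ _) wz) (trans (edge-sym G _ _) xw)

-- A path x - w - y - z without a shortcut would be an induced P₄.
dist≤2-step : IsCograph G → y ∈ U → Dist≤2 G U x y → E G y z ≡ true → Dist≤2 G U x z
dist≤2-step cograph y∈U dist0      yz = dist1 yz
dist≤2-step cograph y∈U (dist1 xy) yz = dist2 y∈U xy yz
dist≤2-step {G = G} {x = x} {z = z} cograph y∈U (dist2 {w} w∈U xw wy) yz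
  with x ≟ z | E G x z in xz | E G w z in wz | E G x _ in xy
... | yes refl | _     | _     | _     = dist0
... | no _     | true  | _     | _     = dist1 xz
... | no _     | false | true  | _     = dist2 w∈U xw wz
... | no _     | false | false | true  = dist2 y∈U xy yz
... | no _     | false | false | false = ⊥-elim (no-P4 {G = G} cograph xw wy yz xy wz xz)

dist≤2-trans : IsCograph G → y ∈ U → Dist≤2 G U x y → Dist≤2 G U y z → Dist≤2 G U x z
dist≤2-trans cograph y∈U xy dist0             = xy
dist≤2-trans cograph y∈U xy (dist1 yz)        = dist≤2-step cograph y∈U xy yz
dist≤2-trans cograph y∈U xy (dist2 w∈U yw wz) =
  dist≤2-step cograph w∈U (dist≤2-step cograph y∈U xy yw) wz

IsAutOn-dist≤2 : IsAutOn G U g → z ∈ U → w ∈ U → Dist≤2 G U z w → Dist≤2 G U (g ⟨$⟩ʳ z) (g ⟨$⟩ʳ w)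
IsAutOn-dist≤2 g-aut z∈U w∈U dist0             = dist0
IsAutOn-dist≤2 g-aut z∈U w∈U (dist1 zw)        = dist1 (trans (preserves-edges g-aut z∈U w∈U) zw)
IsAutOn-dist≤2 g-aut z∈U w∈U (dist2 v∈U zv vw) = dist2 (IsAutOn-∈ g-aut v∈U)
  (trans (preserves-edges g-aut z∈U v∈U) zv) (trans (preserves-edges g-aut v∈U w∈U) vw)

private
  inComponent? : (G : Graph n) (U : Subset n) (x : Fin n) → Decidable (λ z → z ∈ U × Dist≤2 G U x z)
  inComponent? G U x z = z ∈? U ×-dec dist≤2? G U x z

opaque
  component : Graph n → Subset n → Fin n → Subset n
  component G U x = fromDecidable (inComponent? G U x)

  ∈-component⁺ : z ∈ U → Dist≤2 G U x z → z ∈ component G U x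
  ∈-component⁺ {U = U} {G = G} {x = x} z∈U xz = ∈-fromDecidable⁺ (inComponent? G U x) (z∈U , xz)

  ∈-component⁻ : z ∈ component G U x → z ∈ U × Dist≤2 G U x z
  ∈-component⁻ {G = G} {U = U} {x = x} = ∈-fromDecidable⁻ (inComponent? G U x)

  component-⊂ : w ∈ U → ¬ Dist≤2 G U x w → component G U x ⊂ U
  component-⊂ {U = U} {G = G} {x = x} w∈U x↛w =
    fromDecidable-⊂ (inComponent? G U x) proj₁ w∈U (x↛w ∘′ proj₂)

component-union : IsCograph G → IsComponentUnion G U (component G U x)
component-union cograph = record
  { ⊆U          = proj₁ ∘′ ∈-component⁻
  ; no-edge-out = λ z∈C w∈U w∉C → ¬-not λ zw → w∉C (∈-component⁺ w∈U
      (dist≤2-step cograph (proj₁ (∈-component⁻ z∈C)) (proj₂ (∈-component⁻ z∈C)) zw))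
  }

component-⊆ : IsCograph G → y ∈ U → Dist≤2 G U x y → component G U y ⊆ component G U x
component-⊆ cograph y∈U xy z∈ with ∈-component⁻ z∈
... | z∈U , yz = ∈-component⁺ z∈U (dist≤2-trans cograph y∈U xy yz)

IsAutOn-component : IsAutOn G U g → x ∈ U → g ⟨$⟩ʳ x ≡ y →
  z ∈ component G U x → g ⟨$⟩ʳ z ∈ component G U y
IsAutOn-component g-aut x∈U refl z∈ with ∈-component⁻ z∈
... | z∈U , xz = ∈-component⁺ (IsAutOn-∈ g-aut z∈U) (IsAutOn-dist≤2 g-aut x∈U z∈U xz)

-- Seinsche's theorem

-- In a cograph, where Dist≤2 is transitive, this says that G[U] is connected.
Connected : Graph n → Subset n → Fin n → Set
Connected G U x = ∀ {z} → z ∈ U → Dist≤2 G U x z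

Disconnected : Graph n → Subset n → Fin n → Set
Disconnected G U x = ∃[ z ] (z ∈ U × ¬ Dist≤2 G U x z)

connected⊎disconnected : (G : Graph n) (U : Subset n) (x : Fin n) →
  Connected G U x ⊎ Disconnected G U x
connected⊎disconnected G U x with any? (λ z → z ∈? U ×-dec ¬? (dist≤2? G U x z))
... | yes cut  = inj₂ cut
... | no ¬cut  = inj₁ λ {z} z∈U →
  decidable-stable (dist≤2? G U x z) (λ x↛z → ¬cut (z , z∈U , x↛z))

dist≤2-only-via : ∀ {v} → ¬ Dist≤2 G (U ∖ v) x z → Dist≤2 G U x z → E G x v ≡ true × E G v z ≡ true
dist≤2-only-via x↛z dist0                        = contradiction dist0 x↛z
dist≤2-only-via x↛z (dist1 xz)                   = contradiction (dist1 xz) x↛z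
dist≤2-only-via {v = v} x↛z (dist2 {w} w∈U xw wz) with w ≟ v
... | yes refl = xw , wz
... | no w≢v   = contradiction (dist2 (∈-∖⁺ w∈U w≢v) xw wz) x↛z

module _ {H H′ : Graph n} (cograph : IsCograph H) (H∁H′ : Complementary H H′)
         {U : Subset n} {x v : Fin n} where

  -- x reaches u only through v, and x is joined to v in the complement only
  -- through some p; whether or not the neighbour s of x on a short path to p is
  -- adjacent to v, one finds an induced P₄ (p - s - v - u or s - x - v - u).
  private
    cut-vertex-witness : ∀ {u p} → ¬ Dist≤2 H (U ∖ v) x u → E H x v ≡ true → E H v u ≡ true →
      p ∈ U ∖ v → E H x p ≡ false → E H p v ≡ false → x ≢ p → Connected H U x → ⊥
    cut-vertex-witness {u} {p} x↛u xv vu p∈U∖v xp pv x≢p conn with dist≤2? H (U ∖ v) x p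
    ... | no x↛p = true≢false
      (trans (sym (proj₂ (dist≤2-only-via x↛p (conn (proj₁ (∈-∖⁻ p∈U∖v))))))
             (trans (edge-sym H v p) pv))
    ... | yes dist0       = x≢p refl
    ... | yes (dist1 xp′) = true≢false (trans (sym xp′) xp)
    ... | yes x→p@(dist2 {s} s∈U∖v xs sp) = two-P4s
      where
      su : E H s u ≡ false
      su = ¬-not λ su → x↛u (dist2 s∈U∖v xs su)
      xu : E H x u ≡ false
      xu = ¬-not (x↛u ∘′ dist1)
      pu : E H p u ≡ false
      pu = ¬-not (x↛u ∘′ dist≤2-step cograph p∈U∖v x→p)
      two-P4s : ⊥
      two-P4s with E H s v in sv
      ... | true  = no-P4 {G = H} cograph (trans (edge-sym H p s) sp) sv vu pv su pu
      ... | false = no-P4 {G = H} cograph (trans (edge-sym H s x) xs) xv vu sv xu su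

  cut-vertex-impossible : v ∈ U → x ≢ v →
    Disconnected H (U ∖ v) x → Connected H U x → Connected H′ U x → ⊥
  cut-vertex-impossible v∈U x≢v (u , u∈U∖v , x↛u) conn conn′
    with dist≤2-only-via x↛u (conn (proj₁ (∈-∖⁻ u∈U∖v))) | conn′ v∈U
  ... | xv , vu | dist0                 = x≢v refl
  ... | xv , vu | dist1 xv′             = true≢false (trans (sym xv) (complementary-edge H∁H′ xv′))
  ... | xv , vu | dist2 {p} p∈U xp′ pv′ =
    cut-vertex-witness x↛u xv vu (∈-∖⁺ p∈U (edge⇒≢ H′ pv′))
      (complementary-edge H∁H′ xp′) (complementary-edge H∁H′ pv′) (edge⇒≢ H′ xp′) conn

two-vertex-edge : (∀ {w} → w ∈ U → w ≡ x ⊎ w ≡ y) → Dist≤2 G U x y → x ≢ y → E G x y ≡ true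
two-vertex-edge two dist0        x≢y = contradiction refl x≢y
two-vertex-edge two (dist1 xy)   x≢y = xy
two-vertex-edge {G = G} two (dist2 w∈U xw wy) x≢y with two w∈U
... | inj₁ refl = contradiction refl (edge⇒≢ G xw)
... | inj₂ refl = contradiction refl (edge⇒≢ G wy)

connected-coconnected⇒singleton : IsCograph G → x ∈ U →
  Connected G U x → Connected (complement G) U x → ∀ {v} → v ∈ U → v ≡ x
connected-coconnected⇒singleton {G = G} {x = x} {U = U} cograph = go U (⊂-wellFounded U)
  where
  G∁G′ : Complementary G (complement G)
  G∁G′ = complement-complementary
  go : ∀ U → Acc _⊂_ U → x ∈ U →
    Connected G U x → Connected (complement G) U x → ∀ {v} → v ∈ U → v ≡ x
  go U (acc smaller) x∈U conn conn′ {v} v∈U with v ≟ x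
  ... | yes v≡x = v≡x
  ... | no v≢x  = ⊥-elim (second-vertex (v≢x ∘′ sym))
    where
    second-vertex : x ≢ v → ⊥
    second-vertex x≢v
      with connected⊎disconnected G (U ∖ v) x | connected⊎disconnected (complement G) (U ∖ v) x
    ... | inj₂ cut | _        = cut-vertex-impossible cograph G∁G′ v∈U x≢v cut conn conn′
    ... | inj₁ _   | inj₂ cut = cut-vertex-impossible (complementary-isCograph G∁G′ cograph)
                                  (complementary-sym G∁G′) v∈U x≢v cut conn′ conn
    ... | inj₁ c   | inj₁ c′  = true≢false (trans (sym (two-vertex-edge two (conn v∈U) x≢v))
                                  (complementary-edge G∁G′ (two-vertex-edge two (conn′ v∈U) x≢v)))
      where
      two : ∀ {w} → w ∈ U → w ≡ x ⊎ w ≡ v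
      two {w} w∈U with w ≟ v
      ... | yes w≡v = inj₂ w≡v
      ... | no w≢v  = inj₁ (go (U ∖ v) (smaller (∖-⊂ v∈U)) (∈-∖⁺ x∈U x≢v) c c′ (∈-∖⁺ w∈U w≢v))

-- Joint stabilisers

AutFixing : Graph n → Subset n → Vector (Fin n) m → Fin n → Fin n → Set
AutFixing G U s x y = ∃[ g ] (IsAutOn G U g × (∀ i → g ⟨$⟩ʳ s i ≡ s i) × g ⟨$⟩ʳ x ≡ y)

JointStabiliser : Graph n → Subset n → Set
JointStabiliser {n} G U = ∀ {m} {s : Vector (Fin n) m} {x y} → x ∈ U → y ∈ U →
  AutFixing G U [] x y → (∀ i → AutFixing G U (s i ∷ []) x y) → AutFixing G U s x y

AutFixing-complementary : Complementary G H → AutFixing G U s x y → AutFixing H U s x y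
AutFixing-complementary G∁H (g , g-aut , g-fixes , gx) =
  g , IsAutOn-complementary g-aut G∁H , g-fixes , gx

module _ {G : Graph n} (cograph : IsCograph G) {U : Subset n} {x y : Fin n}
         (x∈U : x ∈ U) (y∈U : y ∈ U) where

  swap-components : ¬ Dist≤2 G U x y → AutFixing G U [] x y →
    (∀ i → AutFixing G U (s i ∷ []) x y) → AutFixing G U s x y
  swap-components {s = s} x↛y (h , h-aut , _ , hx) fixing =
    swap , IsAutOn-swap (component-union cograph) (component-union cograph) h-aut ,
    (λ i → swap-outside (s∉Cx i) (s∉Cy i)) , trans (swap-∈C x∈Cx) hx
    where
    Cx = component G U x
    Cy = component G U y
    Cx∩Cy=∅ : z ∈ Cx → z ∉ Cy
    Cx∩Cy=∅ z∈Cx z∈Cy = x↛y (dist≤2-trans cograph (proj₁ (∈-component⁻ z∈Cx))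
      (proj₂ (∈-component⁻ z∈Cx)) (dist≤2-sym (proj₂ (∈-component⁻ z∈Cy))))
    x∈Cx : x ∈ Cx
    x∈Cx = ∈-component⁺ x∈U dist0
    open Swap Cx Cy h Cx∩Cy=∅ (IsAutOn-component h-aut x∈U hx)
      (IsAutOn-component (IsAutOn-flip h-aut) y∈U (⟨$⟩ʳ⇒⟨$⟩ˡ h hx))
    -- an automorphism fixing s i and mapping x to y carries Cx onto Cy
    s∉Cx : ∀ i → s i ∉ Cx
    s∉Cx i si∈Cx with fixing i
    ... | f , f-aut , f-fixes , fx =
      Cx∩Cy=∅ si∈Cx (subst (_∈ Cy) (f-fixes zero) (IsAutOn-component f-aut x∈U fx si∈Cx))
    s∉Cy : ∀ i → s i ∉ Cy
    s∉Cy i si∈Cy with fixing i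
    ... | f , f-aut , f-fixes , fx = Cx∩Cy=∅
      (subst (_∈ Cx) (⟨$⟩ʳ⇒⟨$⟩ˡ f (f-fixes zero))
        (IsAutOn-component (IsAutOn-flip f-aut) y∈U (⟨$⟩ʳ⇒⟨$⟩ˡ f fx) si∈Cy))
      si∈Cy

  within-component : (∀ {C} → C ⊂ U → JointStabiliser G C) → Disconnected G U x → Dist≤2 G U x y →
    AutFixing G U [] x y → (∀ i → AutFixing G U (s i ∷ []) x y) → AutFixing G U s x y
  within-component {s = s} stabiliser (u , u∈U , x↛u) x→y h fixing =
    extend (stabiliser (component-⊂ u∈U x↛u) x∈Cx y∈Cx (restriction h) (λ i → restriction (fixing i)))
    where
    Cx = component G U x
    x∈Cx : x ∈ Cx
    x∈Cx = ∈-component⁺ x∈U dist0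
    y∈Cx : y ∈ Cx
    y∈Cx = ∈-component⁺ y∈U x→y
    restriction : ∀ {k} {t : Vector (Fin n) k} → AutFixing G U t x y → AutFixing G Cx t x y
    restriction {t = t} (g , g-aut , g-fixes , gx) =
      restrict , IsAutOn-restrict (proj₁ ∘′ ∈-component⁻) g-aut ,
      (λ i → restrict-fixes (g-fixes i)) , trans (restrict-∈ x∈Cx) gx
      where
      open Restrict Cx g
        (λ z∈Cx → component-⊆ cograph y∈U x→y (IsAutOn-component g-aut x∈U gx z∈Cx))
        (λ z∈Cx → IsAutOn-component (IsAutOn-flip g-aut) y∈U (⟨$⟩ʳ⇒⟨$⟩ˡ g gx)
                    (component-⊆ cograph x∈U (dist≤2-sym x→y) z∈Cx))
    extend : AutFixing G Cx s x y → AutFixing G U s x y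
    extend (g , g-aut , g-fixes , gx) = g , IsAutOn-extend (component-union cograph) g-aut , g-fixes , gx

  disconnected-jointStabiliser : (∀ {C} → C ⊂ U → JointStabiliser G C) → Disconnected G U x →
    AutFixing G U [] x y → (∀ i → AutFixing G U (s i ∷ []) x y) → AutFixing G U s x y
  disconnected-jointStabiliser stabiliser cut with dist≤2? G U x y
  ... | yes x→y = within-component stabiliser cut x→y
  ... | no x↛y  = swap-components x↛y

jointStabiliser : IsCograph G → (U : Subset n) → JointStabiliser G U
jointStabiliser cograph U = go U (⊂-wellFounded U) cograph
  where
  go : ∀ U → Acc _⊂_ U → ∀ {G} → IsCograph G → JointStabiliser G U
  go U (acc smaller) {G} cograph {x = x} x∈U y∈U h fixing
    with connected⊎disconnected G U x | connected⊎disconnected (complement G) U x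
  ... | inj₂ cut | _ =
    disconnected-jointStabiliser cograph x∈U y∈U (λ C⊂U → go _ (smaller C⊂U) cograph) cut h fixing
  ... | inj₁ _   | inj₂ cut =
    AutFixing-complementary (complementary-sym G∁G′)
      (disconnected-jointStabiliser cograph′ x∈U y∈U (λ C⊂U → go _ (smaller C⊂U) cograph′) cut
        (AutFixing-complementary G∁G′ h) (λ i → AutFixing-complementary G∁G′ (fixing i)))
    where
    G∁G′ : Complementary G (complement G)
    G∁G′ = complement-complementary
    cograph′ : IsCograph (complement G)
    cograph′ = complementary-isCograph G∁G′ cograph
  ... | inj₁ conn | inj₁ conn′ with connected-coconnected⇒singleton cograph x∈U conn conn′ y∈U
  ...   | refl = id , IsAutOn-id , (λ _ → refl) , refl

-- Orbits of tuples

SameOrbit : Graph n → Vector (Fin n) m → Vector (Fin n) m → Set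
SameOrbit G a b = ∃[ g ] (IsAutOn G ⊤ g × ∀ i → g ⟨$⟩ʳ a i ≡ b i)

-- k ∘ g⁻¹ fixes s, because g and k both map a to s.
autFixing-via : {a s : Vector (Fin n) m} → IsAutOn G U g → IsAutOn G U k →
  (∀ i → g ⟨$⟩ʳ a i ≡ s i) → (∀ i → k ⟨$⟩ʳ a i ≡ s i) → k ⟨$⟩ʳ x ≡ y → AutFixing G U s (g ⟨$⟩ʳ x) y
autFixing-via {g = g} {k = k} g-aut k-aut ga≡s ka≡s kx =
  flip g ∘ₚ k , IsAutOn-∘ (IsAutOn-flip g-aut) k-aut ,
  (λ i → trans (cong (k ⟨$⟩ʳ_) (⟨$⟩ʳ⇒⟨$⟩ˡ g (ga≡s i))) (ka≡s i)) ,
  trans (cong (k ⟨$⟩ʳ_) (inverseˡ g)) kx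

pairs⇒sameOrbit : IsCograph G → (a b : Vector (Fin n) m) →
  (∀ i j → SameOrbit G (a i ∷ a j ∷ []) (b i ∷ b j ∷ [])) → SameOrbit G a b
pairs⇒sameOrbit {m = zero}  cograph a b pairs = id , IsAutOn-id , λ ()
pairs⇒sameOrbit {G = G} {m = suc m} cograph a b pairs
  with pairs⇒sameOrbit cograph (a ∘′ suc) (b ∘′ suc) (λ i j → pairs (suc i) (suc j))
... | g , g-aut , g-maps with jointStabiliser cograph ⊤ {s = b ∘′ suc} ∈⊤ ∈⊤ moves fixing
  where
  moves : AutFixing G ⊤ [] (g ⟨$⟩ʳ a zero) (b zero)
  moves with pairs zero zero
  ... | k , k-aut , k-maps = autFixing-via {a = []} g-aut k-aut (λ ()) (λ ()) (k-maps zero)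
  fixing : ∀ i → AutFixing G ⊤ (b (suc i) ∷ []) (g ⟨$⟩ʳ a zero) (b zero)
  fixing i with pairs (suc i) zero
  ... | k , k-aut , k-maps = autFixing-via {a = a (suc i) ∷ []} g-aut k-aut
    (λ { zero → g-maps i }) (λ { zero → k-maps zero }) (k-maps (suc zero))
... | σ , σ-aut , σ-fixes , σx = g ∘ₚ σ , IsAutOn-∘ g-aut σ-aut , λ where
  zero    → σx
  (suc i) → trans (cong (σ ⟨$⟩ʳ_) (g-maps i)) (σ-fixes i)

anyVec? : ∀ k {P : Vec (Fin n) k → Set} → Decidable P → Dec (∃ P)
anyVec? zero    P? = map′ (Vec.[] ,_) (λ { (Vec.[] , p) → p }) (P? Vec.[])
anyVec? (suc k) P? = map′ (λ (x , xs , p) → x Vec.∷ xs , p) (λ { (x Vec.∷ xs , p) → x , xs , p })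
  (any? λ x → anyVec? k (λ xs → P? (x Vec.∷ xs)))

-- A permutation is found by searching its table and the table of its inverse.
anyPermutation? : {P : Permutation′ n → Set} → (∀ {π ρ} → π ≈ ρ → P π → P ρ) →
  (∀ π → Dec (P π)) → Dec (∃ P)
anyPermutation? {n} {P} resp P? =
  map′ fromTables toTables (anyVec? n λ f → anyVec? n λ f⁻¹ → tables? f f⁻¹)
  where
  Inverses : Vec (Fin n) n → Vec (Fin n) n → Set
  Inverses f f⁻¹ =
    StrictlyInverseˡ _≡_ (lookup f) (lookup f⁻¹) × StrictlyInverseʳ _≡_ (lookup f) (lookup f⁻¹)
  fromInverses : ∀ f f⁻¹ → Inverses f f⁻¹ → Permutation′ n
  fromInverses f f⁻¹ (l , r) = permutation (lookup f) (lookup f⁻¹) l r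
  Tables : Vec (Fin n) n → Vec (Fin n) n → Set
  Tables f f⁻¹ = Σ (Inverses f f⁻¹) (P ∘′ fromInverses f f⁻¹)
  tables? : ∀ f f⁻¹ → Dec (Tables f f⁻¹)
  tables? f f⁻¹
    with all? (λ y → lookup f (lookup f⁻¹ y) ≟ y) | all? (λ x → lookup f⁻¹ (lookup f x) ≟ x)
  ... | yes l | yes r =
    map′ ((l , r) ,_) (λ (_ , p) → resp (λ _ → refl) p) (P? (fromInverses f f⁻¹ (l , r)))
  ... | no ¬l | _     = no λ ((l , _) , _) → ¬l l
  ... | yes _ | no ¬r = no λ ((_ , r) , _) → ¬r r
  fromTables : ∃ (λ f → ∃ (Tables f)) → ∃ P
  fromTables (f , f⁻¹ , inverses , p) = fromInverses f f⁻¹ inverses , p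
  toTables : ∃ P → ∃ (λ f → ∃ (Tables f))
  toTables (π , p) =
    tabulate (π ⟨$⟩ʳ_) , tabulate (π ⟨$⟩ˡ_) , (l , r) , resp (λ i → sym (lookup∘tabulate (π ⟨$⟩ʳ_) i)) p
    where
    l : ∀ y → lookup (tabulate (π ⟨$⟩ʳ_)) (lookup (tabulate (π ⟨$⟩ˡ_)) y) ≡ y
    l y = trans (lookup∘tabulate (π ⟨$⟩ʳ_) _)
            (trans (cong (π ⟨$⟩ʳ_) (lookup∘tabulate (π ⟨$⟩ˡ_) y)) (inverseʳ π))
    r : ∀ x → lookup (tabulate (π ⟨$⟩ˡ_)) (lookup (tabulate (π ⟨$⟩ʳ_)) x) ≡ x
    r x = trans (lookup∘tabulate (π ⟨$⟩ˡ_) _)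
            (trans (cong (π ⟨$⟩ˡ_) (lookup∘tabulate (π ⟨$⟩ʳ_) x)) (inverseˡ π))

IsAutOn-resp-≈ : g ≈ h → IsAutOn G U g → IsAutOn G U h
IsAutOn-resp-≈ {G = G} g≈h g-aut = record
  { fixes-outside   = λ x∉U → trans (sym (g≈h _)) (fixes-outside g-aut x∉U)
  ; preserves-edges = λ x∈U y∈U →
      trans (cong₂ (E G) (sym (g≈h _)) (sym (g≈h _))) (preserves-edges g-aut x∈U y∈U)
  }

isAutOn⊤? : (G : Graph n) (g : Permutation′ n) → Dec (IsAutOn G ⊤ g)
isAutOn⊤? G g = map′
  (λ edges → record
    { fixes-outside = λ x∉⊤ → contradiction ∈⊤ x∉⊤ ; preserves-edges = λ _ _ → edges _ _ })
  (λ g-aut x y → preserves-edges g-aut ∈⊤ ∈⊤)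
  (all? λ x → all? λ y → E G (g ⟨$⟩ʳ x) (g ⟨$⟩ʳ y) Bool.≟ E G x y)

sameOrbit? : (G : Graph n) (a b : Vector (Fin n) m) → Dec (SameOrbit G a b)
sameOrbit? G a b = anyPermutation?
  (λ g≈h (g-aut , ga≡b) → IsAutOn-resp-≈ g≈h g-aut , λ i → trans (sym (g≈h _)) (ga≡b i))
  (λ g → isAutOn⊤? G g ×-dec all? λ i → g ⟨$⟩ʳ a i ≟ b i)

orbitRelation : Graph n → Vector (Fin n) m → (Fin m → Fin n) → Bool
orbitRelation G w t = does (sameOrbit? G w t)

orbitRelation-invariant : (G : Graph n) (w : Vector (Fin n) m) → IsInvariant G m (orbitRelation G w)
orbitRelation-invariant G w g g-aut t =
  does-⇔ (mk⇔ backward forward) (sameOrbit? G w ((g ⟨$⟩ʳ_) ∘′ t)) (sameOrbit? G w t)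
  where
  g-aut′ : IsAutOn G ⊤ g
  g-aut′ = IsGraphAut⇒IsAutOn⊤ g-aut
  forward : SameOrbit G w t → SameOrbit G w ((g ⟨$⟩ʳ_) ∘′ t)
  forward (k , k-aut , kw) = k ∘ₚ g , IsAutOn-∘ k-aut g-aut′ , λ i → cong (g ⟨$⟩ʳ_) (kw i)
  backward : SameOrbit G w ((g ⟨$⟩ʳ_) ∘′ t) → SameOrbit G w t
  backward (k , k-aut , kw) =
    k ∘ₚ flip g , IsAutOn-∘ k-aut (IsAutOn-flip g-aut′) , λ i → ⟨$⟩ʳ⇒⟨$⟩ˡ g (sym (kw i))

IsAutOn⊤⇒IsAut-expansion : ∀ {k} → IsAutOn G ⊤ g → IsAut (expansion G k) g
IsAutOn⊤⇒IsAut-expansion g-aut (inj₁ _) t = preserves-edges g-aut ∈⊤ ∈⊤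
IsAutOn⊤⇒IsAut-expansion {G = G} {g = g} g-aut (inj₂ (_ , _ , _ , invariant)) t =
  invariant g (IsAutOn⊤⇒IsGraphAut {G = G} g-aut) t

IsPartialIso⇒sameOrbit-pairs : {a b : Vector (Fin n) m} → IsPartialIso (expansion G 2) a b →
  ∀ i j → SameOrbit G (a i ∷ a j ∷ []) (b i ∷ b j ∷ [])
IsPartialIso⇒sameOrbit-pairs {G = G} {a = a} {b} a≅b i j
  with does≡true⇒ (sameOrbit? G aᵢⱼ (b ∘′ p))
         (trans (a≅b orbit-of-ab p) (dec-true (sameOrbit? G aᵢⱼ (a ∘′ p)) aᵢⱼ~ap))
  where
  p : Vector _ 2
  p = i ∷ j ∷ []
  aᵢⱼ : Vector (Fin _) 2
  aᵢⱼ = a i ∷ a j ∷ []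
  orbit-of-ab : Sym (expansion G 2)
  orbit-of-ab = inj₂ (2 , (s≤s z≤n , ≤-refl) , orbitRelation G aᵢⱼ , orbitRelation-invariant G aᵢⱼ)
  aᵢⱼ~ap : SameOrbit G aᵢⱼ (a ∘′ p)
  aᵢⱼ~ap = id , IsAutOn-id , λ { zero → refl ; (suc zero) → refl }
... | g , g-aut , gab≡bp = g , g-aut , λ { zero → gab≡bp zero ; (suc zero) → gab≡bp (suc zero) }

mainTheorem8 : (n : ℕ) (G : Graph n) → IsCograph G → RelComplexity≤ G 2
mainTheorem8 n G cograph = 2 , ≤-refl , ultrahomogeneous
  where
  ultrahomogeneous : Ultrahomogeneous (expansion G 2)
  ultrahomogeneous m a b _ _ a≅b
    with pairs⇒sameOrbit cograph a b (IsPartialIso⇒sameOrbit-pairs a≅b)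
  ... | g , g-aut , ga≡b = g , IsAutOn⊤⇒IsAut-expansion g-aut , ga≡b
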